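{- Let $G_1,G_2$ be finite simple connected graphs, $G_i$ having $n_i$ vertices and $m_i$ edges. Then the symmetric difference $G_1\oplus G_2$ satisfies \begin{align*} F(G_1\oplus G_2)={}&n_2^4F(G_1)+n_1^4F(G_2)-8F(G_1)F(G_2)+6n_1n_2^2m_2M_1(G_1)+6n_1^2n_2m_1M_1(G_2)\\ &+12n_2F(G_1)M_1(G_2)+12n_1F(G_2)M_1(G_1)-12n_2^2m_2F(G_1)-12n_1^2m_1F(G_2)\\ &-12n_1n_2M_1(G_1)M_1(G_2). \end{align*}
   Context: The symmetric difference $G_1\oplus G_2$ has vertex set $V(G_1)\times V(G_2)$, with $(u_1,u_2)$ adjacent to $(v_1,v_2)$ iff exactly one of the conditions $u_1v_1\in E(G_1)$, $u_2v_2\in E(G_2)$ holds. For a finite simple graph $G$ with vertex degrees $d_G(v)$: $M_1(G)=\sum_{v} d_G(v)^2$ and $F(G)=\sum_{v} d_G(v)^3$. -}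

module Defs where

open import Data.Nat using (ℕ; zero; suc; _+_; _*_; _<ᵇ_)
open import Data.Fin using (Fin; zero; suc; toℕ; remQuot)
open import Data.Bool using (Bool; true; false; _xor_; _∧_; if_then_else_)
open import Data.Product using (_×_; _,_; proj₁; proj₂)
open import Relation.Binary.PropositionalEquality using (_≡_; refl; cong₂)

sumFin : (n : ℕ) → (Fin n → ℕ) → ℕ
sumFin zero    f = 0
sumFin (suc n) f = f zero + sumFin n (λ i → f (suc i))

record Graph (n : ℕ) : Set where
  field
    adj    : Fin n → Fin n → Bool
    sym    : ∀ i j → adj i j ≡ adj j i
    irrefl : ∀ i → adj i i ≡ false
open Graph public

ind : Bool → ℕ
ind true  = 1
ind false = 0

degree : ∀ {n} → Graph n → Fin n → ℕ
degree {n} G v = sumFin n (λ w → ind (adj G v w))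

edges : ∀ {n} → Graph n → ℕ
edges {n} G = sumFin n (λ i → sumFin n (λ j → ind ((toℕ i <ᵇ toℕ j) ∧ adj G i j)))

M₁ : ∀ {n} → Graph n → ℕ
M₁ {n} G = sumFin n (λ v → degree G v * degree G v)

F : ∀ {n} → Graph n → ℕ
F {n} G = sumFin n (λ v → degree G v * degree G v * degree G v)

data Walk {n : ℕ} (G : Graph n) : Fin n → Fin n → Set where
  here : ∀ {v} → Walk G v v
  step : ∀ {u v w} → adj G u v ≡ true → Walk G v w → Walk G u w

Connected : ∀ {n} → Graph n → Set
Connected {n} G = ∀ (u v : Fin n) → Walk G u v

-- Symmetric difference on V(G₁) × V(G₂), encoded as Fin (n₁ * n₂) via remQuot.
xor-cong : ∀ {a b c d : Bool} → a ≡ b → c ≡ d → (a xor c) ≡ (b xor d)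
xor-cong = cong₂ _xor_

fst : ∀ {n₁ n₂} → Fin (n₁ * n₂) → Fin n₁
fst {n₁} {n₂} x = proj₁ (remQuot {n₁} n₂ x)

snd : ∀ {n₁ n₂} → Fin (n₁ * n₂) → Fin n₂
snd {n₁} {n₂} x = proj₂ (remQuot {n₁} n₂ x)

symDiff : ∀ {n₁ n₂} → Graph n₁ → Graph n₂ → Graph (n₁ * n₂)
symDiff {n₁} {n₂} G₁ G₂ = record
  { adj    = λ x y → adj G₁ (fst {n₁} {n₂} x) (fst {n₁} {n₂} y)
                     xor adj G₂ (snd {n₁} {n₂} x) (snd {n₁} {n₂} y)
  ; sym    = λ x y → xor-cong (sym G₁ _ _) (sym G₂ _ _)
  ; irrefl = λ x → irr (irrefl G₁ (fst {n₁} {n₂} x)) (irrefl G₂ (snd {n₁} {n₂} x))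
  }
  where
  irr : ∀ {a b : Bool} → a ≡ false → b ≡ false → (a xor b) ≡ false
  irr refl refl = refl

module Submission where

-- Write a = d₁(i) and b = d₂(j) for the degrees of i ∈ G₁ and j ∈ G₂.
-- Counting the neighbours (k , l) of (i , j) by the indicator identity
-- [p xor q] = [p] + [q] − 2[p][q] gives d(i , j) = n₂ a + n₁ b − 2 a b.
-- Both this count and F(G₁ ⊕ G₂) = Σᵢ Σⱼ d(i , j)³ are double sums of a
-- polynomial in two variables evaluated at (x i , y j); such a sum only
-- depends on the power sums Σᵢ x i ^ p and Σⱼ y j ^ q (lemma sum-poly).
-- The power sums of the degree sequence of a graph are
-- (n , 2m , M₁ , F) for the exponents 0, 1, 2, 3 (the handshake lemma
-- accounts for 2m), so F(G₁ ⊕ G₂) is a polynomial in these invariants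
-- and the theorem is a ring identity.
--
-- The ring
-- identities are checked by the ring solver on their written-out form,
-- which is definitionally the evaluation of the polynomial in question.

open import Defs hiding (sym)
open import Data.Nat as ℕ using (ℕ; zero; suc; _<ᵇ_)
import Data.Nat.Properties as ℕP
open import Data.Fin using (Fin; zero; suc; toℕ; combine; _↑ˡ_; _↑ʳ_; #_)
open import Data.Fin.Properties using (remQuot-combine; toℕ-injective)
open import Data.Bool using (true; false; _xor_; _∧_)
open import Data.Product using (_×_; _,_; proj₁; proj₂)
open import Data.List using (List; []; _∷_)
open import Data.Vec.Functional using (Vector) renaming ([] to ⟨⟩; _∷_ to _◂_)
open import Data.Integer using (ℤ; +_; _+_; _-_; _*_; -_)
import Data.Integer.Properties as ℤP
open import Data.Integer.Tactic.RingSolver using (solve-∀)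
open import Relation.Nullary.Reflects using (ofʸ; ofⁿ)
open import Relation.Nullary.Negation using (contradiction)
open import Relation.Binary.PropositionalEquality
  using (_≡_; _≗_; refl; sym; trans; cong; cong₂; module ≡-Reasoning)
open import Algebra.Properties.Semiring.Sum ℤP.+-*-semiring
  using (sum; sum-syntax; sum-cong-≗; ∑-distrib-+; ∑-comm; sum-replicate-zero; *-distribˡ-sum; *-distribʳ-sum)

open ≡-Reasoning

sumFin-ℤ : ∀ n (f : Fin n → ℕ) → + sumFin n f ≡ ∑[ i < n ] (+ f i)
sumFin-ℤ zero    f = refl
sumFin-ℤ (suc n) f = trans (ℤP.pos-+ (f zero) _) (cong (_+_ (+ f zero)) (sumFin-ℤ n (λ i → f (suc i))))

sum-ones : ∀ n → ∑[ i < n ] (+ 1) ≡ + n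
sum-ones zero    = refl
sum-ones (suc n) = trans (cong (_+_ (+ 1)) (sum-ones n)) (sym (ℤP.pos-+ 1 n))

sum-↑ : ∀ m n (f : Fin (m ℕ.+ n) → ℤ) →
  sum f ≡ ∑[ i < m ] f (i ↑ˡ n) + ∑[ j < n ] f (m ↑ʳ j)
sum-↑ zero    n f = sym (ℤP.+-identityˡ _)
sum-↑ (suc m) n f =
  trans (cong (_+_ (f zero)) (sum-↑ m n (λ i → f (suc i)))) (sym (ℤP.+-assoc (f zero) _ _))

sum-combine : ∀ m n (f : Fin (m ℕ.* n) → ℤ) →
  sum f ≡ ∑[ i < m ] ∑[ j < n ] f (combine i j)
sum-combine zero    n f = refl
sum-combine (suc m) n f =
  trans (sum-↑ n (m ℕ.* n) f) (cong (_+_ (∑[ j < n ] f (j ↑ˡ (m ℕ.* n)))) (sum-combine m n (λ x → f (n ↑ʳ x))))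

sum-separable : ∀ m n (u : Fin m → ℤ) (v : Fin n → ℤ) →
  ∑[ i < m ] ∑[ j < n ] (u i * v j) ≡ sum u * sum v
sum-separable m n u v = begin
  ∑[ i < m ] ∑[ j < n ] (u i * v j)  ≡⟨ sum-cong-≗ (λ i → sym (*-distribˡ-sum (u i) v)) ⟩
  ∑[ i < m ] (u i * sum v)            ≡⟨ sym (*-distribʳ-sum (sum v) u) ⟩
  sum u * sum v                      ∎

double-sum-+ : ∀ m n (f g : Fin m → Fin n → ℤ) →
  ∑[ i < m ] ∑[ j < n ] (f i j + g i j) ≡ ∑[ i < m ] ∑[ j < n ] f i j + ∑[ i < m ] ∑[ j < n ] g i j
double-sum-+ m n f g =
  trans (sum-cong-≗ (λ i → ∑-distrib-+ (f i) (g i))) (∑-distrib-+ (λ i → sum (f i)) (λ i → sum (g i)))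

double-sum-* : ∀ m n c (f : Fin m → Fin n → ℤ) →
  ∑[ i < m ] ∑[ j < n ] (c * f i j) ≡ c * ∑[ i < m ] ∑[ j < n ] f i j
double-sum-* m n c f =
  trans (sum-cong-≗ (λ i → sym (*-distribˡ-sum c (f i)))) (sym (*-distribˡ-sum c (λ i → sum (f i))))

-- A monomial c·xᵖ·yᵠ is stored as (c , p , q); a polynomial is a list of them.
Poly : ℕ → Set
Poly d = List (ℤ × Fin (suc d) × Fin (suc d))

-- Evaluation with the powers xᵖ, yᵠ supplied by the vectors α, β.
-- Evaluating at genuine powers (powers x) gives the polynomial function;
-- evaluating at power sums gives its double sum (sum-poly).
⟦_⟧ : ∀ {d} → Poly d → Vector ℤ (suc d) → Vector ℤ (suc d) → ℤ
⟦ []                ⟧ α β = + 0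
⟦ (c , p , q) ∷ P ⟧ α β = c * (α p * β q) + ⟦ P ⟧ α β

⟦⟧-cong : ∀ {d} (P : Poly d) {α α′ β β′ : Vector ℤ (suc d)} →
  α ≗ α′ → β ≗ β′ → ⟦ P ⟧ α β ≡ ⟦ P ⟧ α′ β′
⟦⟧-cong []                α≗ β≗ = refl
⟦⟧-cong ((c , p , q) ∷ P) α≗ β≗ =
  cong₂ _+_ (cong (c *_) (cong₂ _*_ (α≗ p) (β≗ q))) (⟦⟧-cong P α≗ β≗)

-- Powers, normalised so that pow x 1 is x and pow x (k + 2) is pow x (k + 1) * x;
-- thus pow x 2 and pow x 3 are literally x * x and x * x * x, the products
-- used in the definitions of M₁ and F.
pow : ℤ → ℕ → ℤ
pow x zero          = + 1
pow x (suc zero)    = x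
pow x (suc (suc k)) = pow x (suc k) * x

powers : ∀ {d} → ℤ → Vector ℤ (suc d)
powers x p = pow x (toℕ p)

powerSums : ∀ {d n} → (Fin n → ℤ) → Vector ℤ (suc d)
powerSums {n = n} x p = ∑[ i < n ] pow (x i) (toℕ p)

sum-poly : ∀ {d m n} (P : Poly d) (x : Fin m → ℤ) (y : Fin n → ℤ) →
  ∑[ i < m ] ∑[ j < n ] ⟦ P ⟧ (powers (x i)) (powers (y j)) ≡ ⟦ P ⟧ (powerSums x) (powerSums y)
sum-poly {m = m} {n} [] x y =
  trans (sum-cong-≗ {m} (λ i → sum-replicate-zero n)) (sum-replicate-zero m)
sum-poly {m = m} {n} ((c , p , q) ∷ P) x y = begin
  ∑[ i < m ] ∑[ j < n ] (c * (powers (x i) p * powers (y j) q) + ⟦ P ⟧ (powers (x i)) (powers (y j)))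
    ≡⟨ double-sum-+ m n _ _ ⟩
  ∑[ i < m ] ∑[ j < n ] (c * (powers (x i) p * powers (y j) q)) + ∑[ i < m ] ∑[ j < n ] ⟦ P ⟧ (powers (x i)) (powers (y j))
    ≡⟨ cong₂ _+_ (trans (double-sum-* m n c _) (cong (c *_) (sum-separable m n _ _))) (sum-poly P x y) ⟩
  c * (powerSums x p * powerSums y q) + ⟦ P ⟧ (powerSums x) (powerSums y) ∎

powerSum-zero : ∀ {d n} (x : Fin n → ℤ) → powerSums {d} x zero ≡ + n
powerSum-zero {n = n} x = sum-ones n

forward : ∀ {n} → Graph n → Fin n → Fin n → ℤ
forward G i j = + ind ((toℕ i <ᵇ toℕ j) ∧ adj G i j)

edges-ℤ : ∀ {n} (G : Graph n) → + edges G ≡ ∑[ i < n ] ∑[ j < n ] forward G i j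
edges-ℤ {n} G = trans (sumFin-ℤ n _) (sum-cong-≗ {n} (λ i → sumFin-ℤ n _))

-- Every adjacent pair is counted exactly once, as ij with i < j or as ji
-- with j < i; a vertex is never adjacent to itself.
adjacency-split : ∀ {n} (G : Graph n) i j →
  ind (adj G i j) ≡ ind ((toℕ i <ᵇ toℕ j) ∧ adj G i j) ℕ.+ ind ((toℕ j <ᵇ toℕ i) ∧ adj G j i)
adjacency-split G i j
  with toℕ i <ᵇ toℕ j | ℕP.<ᵇ-reflects-< (toℕ i) (toℕ j)
     | toℕ j <ᵇ toℕ i | ℕP.<ᵇ-reflects-< (toℕ j) (toℕ i)
... | true  | ofʸ i<j | true  | ofʸ j<i = contradiction j<i (ℕP.<-asym i<j)
... | true  | ofʸ _   | false | ofⁿ _   = sym (ℕP.+-identityʳ _)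
... | false | ofⁿ _   | true  | ofʸ _   = cong ind (Graph.sym G i j)
... | false | ofⁿ i≮j | false | ofⁿ j≮i
  with toℕ-injective (ℕP.≤-antisym (ℕP.≮⇒≥ j≮i) (ℕP.≮⇒≥ i≮j))
...   | refl = cong ind (irrefl G i)

-- Handshake lemma: the degrees add up to twice the number of edges, since
-- each edge ij is counted once at i and once at j.
handshake : ∀ {n} (G : Graph n) → ∑[ i < n ] (+ degree G i) ≡ + 2 * + edges G
handshake {n} G = begin
  ∑[ i < n ] (+ degree G i)
    ≡⟨ sum-cong-≗ {n} (λ i → sumFin-ℤ n _) ⟩
  ∑[ i < n ] ∑[ j < n ] (+ ind (adj G i j))
    ≡⟨ sum-cong-≗ (λ i → sum-cong-≗ (λ j → split i j)) ⟩
  ∑[ i < n ] ∑[ j < n ] (forward G i j + forward G j i)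
    ≡⟨ double-sum-+ n n (forward G) (λ i j → forward G j i) ⟩
  E + ∑[ i < n ] ∑[ j < n ] forward G j i
    ≡⟨ cong (_+_ E) (∑-comm (λ i j → forward G j i)) ⟩
  E + E
    ≡⟨ cong (λ e → e + e) (sym (edges-ℤ G)) ⟩
  + edges G + + edges G
    ≡⟨ doubling (+ edges G) ⟩
  + 2 * + edges G ∎
  where
  E : ℤ
  E = ∑[ i < n ] ∑[ j < n ] forward G i j
  split : ∀ i j → + ind (adj G i j) ≡ forward G i j + forward G j i
  split i j = trans (cong +_ (adjacency-split G i j)) (ℤP.pos-+ (ind ((toℕ i <ᵇ toℕ j) ∧ adj G i j)) _)
  doubling : ∀ e → e + e ≡ + 2 * e
  doubling = solve-∀

degrees : ∀ {n} → Graph n → Fin n → ℤ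
degrees G i = + degree G i

-- The invariants entering the theorem, indexed by the exponent 0, 1, 2, 3.
invariants : ∀ {n} → Graph n → Vector ℤ 4
invariants {n} G = + n ◂ + 2 * + edges G ◂ + M₁ G ◂ + F G ◂ ⟨⟩

pos-cube : ∀ d → + (d ℕ.* d ℕ.* d) ≡ + d * + d * + d
pos-cube d = trans (ℤP.pos-* (d ℕ.* d) d) (cong (λ z → z * + d) (ℤP.pos-* d d))

degree-powerSums : ∀ {n} (G : Graph n) → powerSums (degrees G) ≗ invariants G
degree-powerSums G zero                   = powerSum-zero {3} (degrees G)
degree-powerSums G (suc zero)             = handshake G
degree-powerSums {n} G (suc (suc zero))   =
  sym (trans (sumFin-ℤ n _) (sum-cong-≗ {n} (λ i → ℤP.pos-* (degree G i) (degree G i))))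
degree-powerSums {n} G (suc (suc (suc zero))) =
  sym (trans (sumFin-ℤ n _) (sum-cong-≗ {n} (λ i → pos-cube (degree G i))))

fst-combine : ∀ {n₁ n₂} (i : Fin n₁) (j : Fin n₂) → fst {n₁} {n₂} (combine i j) ≡ i
fst-combine {n₁} {n₂} i j = cong proj₁ (remQuot-combine {n₁} {n₂} i j)

snd-combine : ∀ {n₁ n₂} (i : Fin n₁) (j : Fin n₂) → snd {n₁} {n₂} (combine i j) ≡ j
snd-combine {n₁} {n₂} i j = cong proj₂ (remQuot-combine {n₁} {n₂} i j)

symDiff-adj : ∀ {n₁ n₂} (G₁ : Graph n₁) (G₂ : Graph n₂) i j k l →
  adj (symDiff G₁ G₂) (combine i j) (combine k l) ≡ adj G₁ i k xor adj G₂ j l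
symDiff-adj G₁ G₂ i j k l =
  cong₂ _xor_ (cong₂ (adj G₁) (fst-combine i j) (fst-combine k l))
              (cong₂ (adj G₂) (snd-combine i j) (snd-combine k l))

-- The polynomial x + y − 2xy, which computes exclusive or on {0, 1}.
xorPoly : Poly 1
xorPoly = (+ 1 , # 1 , # 0) ∷ (+ 1 , # 0 , # 1) ∷ (- + 2 , # 1 , # 1) ∷ []

indicator-xor : ∀ p q → + ind (p xor q) ≡ ⟦ xorPoly ⟧ (powers (+ ind p)) (powers (+ ind q))
indicator-xor false false = refl
indicator-xor false true  = refl
indicator-xor true  false = refl
indicator-xor true  true  = refl

xorPoly-value : ∀ N₁ N₂ a b →
  ⟦ xorPoly ⟧ (N₁ ◂ a ◂ ⟨⟩) (N₂ ◂ b ◂ ⟨⟩) ≡ N₂ * a + N₁ * b - + 2 * (a * b)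
xorPoly-value = expanded
  where
  expanded : ∀ N₁ N₂ a b →
    + 1 * (a * N₂) + (+ 1 * (N₁ * b) + (- + 2 * (a * b) + + 0)) ≡ N₂ * a + N₁ * b - + 2 * (a * b)
  expanded = solve-∀

symDiff-degree : ∀ {n₁ n₂} (G₁ : Graph n₁) (G₂ : Graph n₂) i j →
  + degree (symDiff G₁ G₂) (combine i j) ≡
    + n₂ * + degree G₁ i + + n₁ * + degree G₂ j - + 2 * (+ degree G₁ i * + degree G₂ j)
symDiff-degree {n₁} {n₂} G₁ G₂ i j = begin
  + degree (symDiff G₁ G₂) (combine i j)
    ≡⟨ trans (sumFin-ℤ (n₁ ℕ.* n₂) _) (sum-combine n₁ n₂ _) ⟩
  ∑[ k < n₁ ] ∑[ l < n₂ ] (+ ind (adj (symDiff G₁ G₂) (combine i j) (combine k l)))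
    ≡⟨ sum-cong-≗ {n₁} (λ k → sum-cong-≗ {n₂} (λ l → cong (λ b → + ind b) (symDiff-adj G₁ G₂ i j k l))) ⟩
  ∑[ k < n₁ ] ∑[ l < n₂ ] (+ ind (adj G₁ i k xor adj G₂ j l))
    ≡⟨ sum-cong-≗ {n₁} (λ k → sum-cong-≗ {n₂} (λ l → indicator-xor (adj G₁ i k) (adj G₂ j l))) ⟩
  ∑[ k < n₁ ] ∑[ l < n₂ ] ⟦ xorPoly ⟧ (powers (x k)) (powers (y l))
    ≡⟨ sum-poly xorPoly x y ⟩
  ⟦ xorPoly ⟧ (powerSums x) (powerSums y)
    ≡⟨ ⟦⟧-cong xorPoly (row-powerSums G₁ i) (row-powerSums G₂ j) ⟩
  ⟦ xorPoly ⟧ (+ n₁ ◂ + degree G₁ i ◂ ⟨⟩) (+ n₂ ◂ + degree G₂ j ◂ ⟨⟩)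
    ≡⟨ xorPoly-value (+ n₁) (+ n₂) (+ degree G₁ i) (+ degree G₂ j) ⟩
  + n₂ * + degree G₁ i + + n₁ * + degree G₂ j - + 2 * (+ degree G₁ i * + degree G₂ j) ∎
  where
  x : Fin n₁ → ℤ
  x k = + ind (adj G₁ i k)
  y : Fin n₂ → ℤ
  y l = + ind (adj G₂ j l)
  row-powerSums : ∀ {n} (G : Graph n) v →
    powerSums (λ w → + ind (adj G v w)) ≗ (+ n ◂ + degree G v ◂ ⟨⟩)
  row-powerSums G v zero           = powerSum-zero {1} (λ w → + ind (adj G v w))
  row-powerSums {n} G v (suc zero) = sym (sumFin-ℤ n _)

-- (N₂ x + N₁ y − 2xy)³ written as a list of monomials c·xᵖ·yᵠ.
cubePoly : ℤ → ℤ → Poly 3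
cubePoly N₁ N₂ =
  (N₂ * N₂ * N₂       , # 3 , # 0) ∷
  (N₁ * N₁ * N₁       , # 0 , # 3) ∷
  (- + 8              , # 3 , # 3) ∷
  (+ 3 * N₁ * N₂ * N₂ , # 2 , # 1) ∷
  (+ 3 * N₁ * N₁ * N₂ , # 1 , # 2) ∷
  (- + 6 * N₂ * N₂    , # 3 , # 1) ∷
  (- + 6 * N₁ * N₁    , # 1 , # 3) ∷
  (+ 12 * N₂          , # 3 , # 2) ∷
  (+ 12 * N₁          , # 2 , # 3) ∷
  (- + 12 * N₁ * N₂   , # 2 , # 2) ∷ []

cube-expansion : ∀ N₁ N₂ a b →
  pow (N₂ * a + N₁ * b - + 2 * (a * b)) 3 ≡ ⟦ cubePoly N₁ N₂ ⟧ (powers a) (powers b)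
cube-expansion = expanded
  where
  expanded : ∀ N₁ N₂ a b →
    (N₂ * a + N₁ * b - + 2 * (a * b)) * (N₂ * a + N₁ * b - + 2 * (a * b)) * (N₂ * a + N₁ * b - + 2 * (a * b)) ≡
      N₂ * N₂ * N₂ * (a * a * a * + 1) +
      (N₁ * N₁ * N₁ * (+ 1 * (b * b * b)) +
      (- + 8 * (a * a * a * (b * b * b)) +
      (+ 3 * N₁ * N₂ * N₂ * (a * a * b) +
      (+ 3 * N₁ * N₁ * N₂ * (a * (b * b)) +
      (- + 6 * N₂ * N₂ * (a * a * a * b) +
      (- + 6 * N₁ * N₁ * (a * (b * b * b)) +
      (+ 12 * N₂ * (a * a * a * (b * b)) +
      (+ 12 * N₁ * (a * a * (b * b * b)) +
      (- + 12 * N₁ * N₂ * (a * a * (b * b)) + + 0)))))))))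
  expanded = solve-∀

cubePoly-value : ∀ N₁ N₂ e₁ e₂ m₁ m₂ f₁ f₂ →
  ⟦ cubePoly N₁ N₂ ⟧ (N₁ ◂ + 2 * e₁ ◂ m₁ ◂ f₁ ◂ ⟨⟩) (N₂ ◂ + 2 * e₂ ◂ m₂ ◂ f₂ ◂ ⟨⟩) ≡
    N₂ * N₂ * N₂ * N₂ * f₁ + N₁ * N₁ * N₁ * N₁ * f₂
    - + 8 * f₁ * f₂
    + + 6 * N₁ * N₂ * N₂ * e₂ * m₁
    + + 6 * N₁ * N₁ * N₂ * e₁ * m₂
    + + 12 * N₂ * f₁ * m₂
    + + 12 * N₁ * f₂ * m₁
    - + 12 * N₂ * N₂ * e₂ * f₁
    - + 12 * N₁ * N₁ * e₁ * f₂
    - + 12 * N₁ * N₂ * m₁ * m₂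
cubePoly-value = expanded
  where
  expanded : ∀ N₁ N₂ e₁ e₂ m₁ m₂ f₁ f₂ →
    N₂ * N₂ * N₂ * (f₁ * N₂) +
    (N₁ * N₁ * N₁ * (N₁ * f₂) +
    (- + 8 * (f₁ * f₂) +
    (+ 3 * N₁ * N₂ * N₂ * (m₁ * (+ 2 * e₂)) +
    (+ 3 * N₁ * N₁ * N₂ * (+ 2 * e₁ * m₂) +
    (- + 6 * N₂ * N₂ * (f₁ * (+ 2 * e₂)) +
    (- + 6 * N₁ * N₁ * (+ 2 * e₁ * f₂) +
    (+ 12 * N₂ * (f₁ * m₂) +
    (+ 12 * N₁ * (m₁ * f₂) +
    (- + 12 * N₁ * N₂ * (m₁ * m₂) + + 0))))))))) ≡
      N₂ * N₂ * N₂ * N₂ * f₁ + N₁ * N₁ * N₁ * N₁ * f₂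
      - + 8 * f₁ * f₂
      + + 6 * N₁ * N₂ * N₂ * e₂ * m₁
      + + 6 * N₁ * N₁ * N₂ * e₁ * m₂
      + + 12 * N₂ * f₁ * m₂
      + + 12 * N₁ * f₂ * m₁
      - + 12 * N₂ * N₂ * e₂ * f₁
      - + 12 * N₁ * N₁ * e₁ * f₂
      - + 12 * N₁ * N₂ * m₁ * m₂
  expanded = solve-∀

forgotten-symDiff : ∀ {n₁ n₂} (G₁ : Graph n₁) (G₂ : Graph n₂) →
  + F (symDiff G₁ G₂) ≡ ⟦ cubePoly (+ n₁) (+ n₂) ⟧ (invariants G₁) (invariants G₂)
forgotten-symDiff {n₁} {n₂} G₁ G₂ = begin
  + F (symDiff G₁ G₂)
    ≡⟨ trans (sumFin-ℤ (n₁ ℕ.* n₂) _) (sum-combine n₁ n₂ _) ⟩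
  ∑[ i < n₁ ] ∑[ j < n₂ ] (+ cube (degree (symDiff G₁ G₂) (combine i j)))
    ≡⟨ sum-cong-≗ {n₁} (λ i → sum-cong-≗ {n₂} (λ j → vertex-term i j)) ⟩
  ∑[ i < n₁ ] ∑[ j < n₂ ] ⟦ cubePoly (+ n₁) (+ n₂) ⟧ (powers (degrees G₁ i)) (powers (degrees G₂ j))
    ≡⟨ sum-poly (cubePoly (+ n₁) (+ n₂)) (degrees G₁) (degrees G₂) ⟩
  ⟦ cubePoly (+ n₁) (+ n₂) ⟧ (powerSums (degrees G₁)) (powerSums (degrees G₂))
    ≡⟨ ⟦⟧-cong (cubePoly (+ n₁) (+ n₂)) (degree-powerSums G₁) (degree-powerSums G₂) ⟩
  ⟦ cubePoly (+ n₁) (+ n₂) ⟧ (invariants G₁) (invariants G₂) ∎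
  where
  cube : ℕ → ℕ
  cube d = d ℕ.* d ℕ.* d
  vertex-term : ∀ i j → + cube (degree (symDiff G₁ G₂) (combine i j)) ≡
    ⟦ cubePoly (+ n₁) (+ n₂) ⟧ (powers (degrees G₁ i)) (powers (degrees G₂ j))
  vertex-term i j = begin
    + cube (degree (symDiff G₁ G₂) (combine i j))
      ≡⟨ pos-cube (degree (symDiff G₁ G₂) (combine i j)) ⟩
    pow (+ degree (symDiff G₁ G₂) (combine i j)) 3
      ≡⟨ cong (λ z → pow z 3) (symDiff-degree G₁ G₂ i j) ⟩
    pow (+ n₂ * degrees G₁ i + + n₁ * degrees G₂ j - + 2 * (degrees G₁ i * degrees G₂ j)) 3
      ≡⟨ cube-expansion (+ n₁) (+ n₂) (degrees G₁ i) (degrees G₂ j) ⟩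
    ⟦ cubePoly (+ n₁) (+ n₂) ⟧ (powers (degrees G₁ i)) (powers (degrees G₂ j)) ∎

theorem11 : ∀ {n₁ n₂ : ℕ} (G₁ : Graph n₁) (G₂ : Graph n₂) →
    Connected G₁ → Connected G₂ →
    + F (symDiff G₁ G₂) ≡
      + n₂ * + n₂ * + n₂ * + n₂ * + F G₁ + + n₁ * + n₁ * + n₁ * + n₁ * + F G₂
      - + 8 * + F G₁ * + F G₂
      + + 6 * + n₁ * + n₂ * + n₂ * + edges G₂ * + M₁ G₁
      + + 6 * + n₁ * + n₁ * + n₂ * + edges G₁ * + M₁ G₂
      + + 12 * + n₂ * + F G₁ * + M₁ G₂
      + + 12 * + n₁ * + F G₂ * + M₁ G₁
      - + 12 * + n₂ * + n₂ * + edges G₂ * + F G₁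
      - + 12 * + n₁ * + n₁ * + edges G₁ * + F G₂
      - + 12 * + n₁ * + n₂ * + M₁ G₁ * + M₁ G₂
theorem11 {n₁} {n₂} G₁ G₂ _ _ =
  trans (forgotten-symDiff G₁ G₂)
        (cubePoly-value (+ n₁) (+ n₂) (+ edges G₁) (+ edges G₂) (+ M₁ G₁) (+ M₁ G₂) (+ F G₁) (+ F G₂))
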